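{- If $G$ is a $k$-regular finite simple graph with $k>1$, then the $1$-shunt intersection graph $A_1(G)$ is $(4k-3)$-regular.
   Context: A $1$-arc of $G$ is an ordered pair $(u,v)$ with $uv\in E(G)$, written $uv$; it can be shunted onto the $1$-arc $vw$ if $w\neq u$ and $vw\in E(G)$. $A_1(G)$ has as vertices the $1$-arcs that can be shunted onto some other $1$-arc; two distinct vertices are adjacent iff the corresponding $1$-arcs share a vertex of $G$. -}

module Defs where

open import Data.Nat using (ℕ)
open import Data.Bool using (Bool; true; false)
open import Data.Fin using (Fin)
open import Data.Fin.Properties using (any?) renaming (_≟_ to _≟F_)
open import Data.Product using (Σ; ∃; _×_; _,_; proj₁; proj₂)
open import Data.Product.Properties using (≡-dec)
open import Data.Sum using (_⊎_)
open import Data.List using (List; length; filter; cartesianProduct)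
open import Data.List using (allFin)
open import Relation.Nullary using (¬_; Dec; yes; no)
open import Relation.Nullary.Decidable using (_×-dec_; _⊎-dec_; ¬?)
open import Relation.Binary.PropositionalEquality using (_≡_; _≢_)

record SimpleGraph (n : ℕ) : Set where
  field
    adj   : Fin n → Fin n → Bool
    sym   : ∀ u v → adj u v ≡ adj v u
    irrefl : ∀ u → adj u u ≡ false

module _ {n : ℕ} (G : SimpleGraph n) where
  open SimpleGraph G

  Adj : Fin n → Fin n → Set
  Adj u v = adj u v ≡ true

  Adj? : ∀ u v → Dec (Adj u v)
  Adj? u v = Data.Bool._≟_ (adj u v) true
    where import Data.Bool

  degree : Fin n → ℕ
  degree u = length (filter (Adj? u) (allFin n))

  Regular : ℕ → Set
  Regular k = ∀ u → degree u ≡ k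

  Arc : Fin n × Fin n → Set
  Arc (u , v) = Adj u v

  ShuntsOnto : Fin n × Fin n → Fin n × Fin n → Set
  ShuntsOnto (u , v) (v' , w) = Arc (u , v) × Arc (v' , w) × v ≡ v' × w ≢ u

  IsA₁Vertex : Fin n × Fin n → Set
  IsA₁Vertex a = ∃ λ b → ShuntsOnto a b

  IsA₁Vertex? : ∀ a → Dec (IsA₁Vertex a)
  IsA₁Vertex? (u , v) with Adj? u v
  ... | no ¬a = no λ { (_ , a , _) → ¬a a }
  ... | yes a with any? (λ w → Adj? v w ×-dec ¬? (w ≟F u))
  ...   | yes (w , vw , w≢u) = yes ((v , w) , a , vw , _≡_.refl , w≢u)
  ...   | no ¬e = no λ { ((.v , w) , _ , vw , _≡_.refl , w≢u) → ¬e (w , vw , w≢u) }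

  ShareVertex : Fin n × Fin n → Fin n × Fin n → Set
  ShareVertex (u , v) (u' , v') = (u ≡ u' ⊎ u ≡ v') ⊎ (v ≡ u' ⊎ v ≡ v')

  ShareVertex? : ∀ a b → Dec (ShareVertex a b)
  ShareVertex? (u , v) (u' , v') =
    ((u ≟F u') ⊎-dec (u ≟F v')) ⊎-dec ((v ≟F u') ⊎-dec (v ≟F v'))

  A₁Adj : Fin n × Fin n → Fin n × Fin n → Set
  A₁Adj a b = IsA₁Vertex a × IsA₁Vertex b × a ≢ b × ShareVertex a b

  A₁Adj? : ∀ a b → Dec (A₁Adj a b)
  A₁Adj? a b = IsA₁Vertex? a ×-dec IsA₁Vertex? b
               ×-dec ¬? (≡-dec _≟F_ _≟F_ a b) ×-dec ShareVertex? a b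

  A₁degree : Fin n × Fin n → ℕ
  A₁degree a = length (filter (A₁Adj? a) (cartesianProduct (allFin n) (allFin n)))

  A₁Regular : ℕ → Set
  A₁Regular d = ∀ a → IsA₁Vertex a → A₁degree a ≡ d

-- Since k > 1 the head of every arc has a second neighbour, so every arc is a vertex of A₁(G) and the
-- A₁-neighbours of an arc uv are the arcs xy ≠ uv meeting {u, v}. Each of u, v is the tail of deg and the
-- head of deg arcs, giving 2 (deg u + deg v) incidences between arcs and {u, v}. The arcs uv and vu are
-- the only ones meeting {u, v} twice, and uv itself is not a neighbour, so uv has 2 (deg u + deg v) − 3
-- = 4k − 3 neighbours.
module Submission where

open import Defs
open import Data.Nat using (ℕ; zero; suc; _+_; _*_; _∸_; _≤_; _<_; _>_; z≤n)
open import Data.Nat.Properties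
  using (<⇒≱; +-*-semiring; +-identityʳ; *-identityʳ; *-identityˡ; *-zeroʳ; m+n∸n≡m; +-mono-≤; +-assoc; ≤-refl; module ≤-Reasoning)
open import Data.Nat.Tactic.RingSolver using (solve-∀)
open import Algebra.Properties.Semiring.Sum +-*-semiring
  using (sum; sum-syntax; ∑-distrib-+; sum-cong-≗; *-distribʳ-sum; *-distribˡ-sum; sum-replicate-zero)
open import Data.Bool using (if_then_else_; true; false)
open import Data.Fin using (Fin) renaming (zero to fzero; suc to fsuc)
open import Data.Fin.Properties using (any?; _≟_)
open import Data.Product using (∃; _×_; _,_)
open import Data.List using (_++_; length; filter; cartesianProduct; tabulate; map)
open import Data.List.Properties using (filter-++; length-++; map-tabulate)
open import Function using (_∘_; _⇔_; mk⇔)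
open import Relation.Nullary using (¬_; Dec; yes; no; does; contradiction)
open import Relation.Nullary.Decidable using (does-⇔; _×-dec_; ¬?)
open import Relation.Unary using (Decidable)
open import Relation.Binary.PropositionalEquality using (_≡_; _≢_; refl; sym; trans; cong; cong₂; subst; module ≡-Reasoning)

𝟙 : {P : Set} → Dec P → ℕ
𝟙 P? = if does P? then 1 else 0

𝟙-⇔ : {P Q : Set} → P ⇔ Q → (P? : Dec P) (Q? : Dec Q) → 𝟙 P? ≡ 𝟙 Q?
𝟙-⇔ P⇔Q P? Q? = cong (λ b → if b then 1 else 0) (does-⇔ P⇔Q P? Q?)

δ : ∀ {m} → Fin m → Fin m → ℕ
δ i j = 𝟙 (i ≟ j)

∑-*-δ : ∀ {m} (i : Fin m) (f : Fin m → ℕ) → ∑[ j < m ] (f j * δ i j) ≡ f i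
∑-*-δ {suc m} fzero    f = begin
  f fzero * 1 + ∑[ j < m ] (f (fsuc j) * 0)  ≡⟨ cong₂ _+_ (*-identityʳ (f fzero)) (sum-cong-≗ (*-zeroʳ ∘ f ∘ fsuc)) ⟩
  f fzero + ∑[ j < m ] 0                    ≡⟨ cong (f fzero +_) (sum-replicate-zero m) ⟩
  f fzero + 0                               ≡⟨ +-identityʳ (f fzero) ⟩
  f fzero                                   ∎
  where open ≡-Reasoning
∑-*-δ {suc m} (fsuc i) f =
  trans (cong (_+ ∑[ j < m ] (f (fsuc j) * δ i j)) (*-zeroʳ (f fzero))) (∑-*-δ i (f ∘ fsuc))

∑-δ : ∀ {m} (i : Fin m) → ∑[ j < m ] δ i j ≡ 1
∑-δ i = trans (sum-cong-≗ (λ j → sym (*-identityˡ (δ i j)))) (∑-*-δ i (λ _ → 1))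

δ*δ≡0 : ∀ {m} (a b x y : Fin m) → ¬ (a ≡ x × b ≡ y) → δ a x * δ b y ≡ 0
δ*δ≡0 a b x y ¬eq with a ≟ x | b ≟ y
... | yes a≡x | yes b≡y = contradiction (a≡x , b≡y) ¬eq
... | yes _   | no _    = refl
... | no _    | _       = refl

∑-mono-≤ : ∀ {m} {f g : Fin m → ℕ} → (∀ i → f i ≤ g i) → ∑[ i < m ] f i ≤ ∑[ i < m ] g i
∑-mono-≤ {zero}  f≤g = z≤n
∑-mono-≤ {suc m} f≤g = +-mono-≤ (f≤g fzero) (∑-mono-≤ (f≤g ∘ fsuc))

∑∑ : ∀ {m} → (Fin m → Fin m → ℕ) → ℕ
∑∑ {m} f = ∑[ x < m ] ∑[ y < m ] f x y

∑∑-distrib-+ : ∀ {m} (f g : Fin m → Fin m → ℕ) → ∑∑ (λ x y → f x y + g x y) ≡ ∑∑ f + ∑∑ g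
∑∑-distrib-+ f g =
  trans (sum-cong-≗ (λ x → ∑-distrib-+ (f x) (g x))) (∑-distrib-+ (sum ∘ f) (sum ∘ g))

∑∑-*ˡ : ∀ {m} c (f : Fin m → Fin m → ℕ) → ∑∑ (λ x y → c * f x y) ≡ c * ∑∑ f
∑∑-*ˡ c f = trans (sum-cong-≗ (λ x → sym (*-distribˡ-sum c (f x)))) (sym (*-distribˡ-sum c (sum ∘ f)))

∑∑-*-δˡ : ∀ {m} (w : Fin m) (f : Fin m → Fin m → ℕ) → ∑∑ (λ x y → f x y * δ w x) ≡ sum (f w)
∑∑-*-δˡ w f = trans (sum-cong-≗ (λ x → sym (*-distribʳ-sum (δ w x) (f x)))) (∑-*-δ w (sum ∘ f))

∑∑-*-δʳ : ∀ {m} (w : Fin m) (f : Fin m → Fin m → ℕ) → ∑∑ (λ x y → f x y * δ w y) ≡ ∑[ x < m ] f x w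
∑∑-*-δʳ w f = sum-cong-≗ (λ x → ∑-*-δ w (f x))

∑∑-δδ : ∀ {m} (a b : Fin m) → ∑∑ (λ x y → δ a x * δ b y) ≡ 1
∑∑-δδ a b = trans (∑∑-*-δʳ b (λ x _ → δ a x)) (∑-δ a)

∑∑-+δδ : ∀ {m} (f : Fin m → Fin m → ℕ) (a b : Fin m) →
  ∑∑ (λ x y → f x y + 2 * (δ a x * δ b y) + δ b x * δ a y) ≡ ∑∑ f + 3
∑∑-+δδ f a b = begin
  ∑∑ (λ x y → f x y + 2 * [ab] x y + [ba] x y)      ≡⟨ ∑∑-distrib-+ (λ x y → f x y + 2 * [ab] x y) [ba] ⟩
  ∑∑ (λ x y → f x y + 2 * [ab] x y) + ∑∑ [ba]       ≡⟨ cong (_+ ∑∑ [ba]) (∑∑-distrib-+ f (λ x y → 2 * [ab] x y)) ⟩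
  ∑∑ f + ∑∑ (λ x y → 2 * [ab] x y) + ∑∑ [ba]       ≡⟨ cong (λ p → ∑∑ f + p + ∑∑ [ba]) (∑∑-*ˡ 2 [ab]) ⟩
  ∑∑ f + 2 * ∑∑ [ab] + ∑∑ [ba]                     ≡⟨ cong₂ (λ p q → ∑∑ f + 2 * p + q) (∑∑-δδ a b) (∑∑-δδ b a) ⟩
  ∑∑ f + 2 * 1 + 1                                 ≡⟨ +-assoc (∑∑ f) 2 1 ⟩
  ∑∑ f + 3                                         ∎
  where
  open ≡-Reasoning
  [ab] [ba] : Fin _ → Fin _ → ℕ
  [ab] x y = δ a x * δ b y
  [ba] x y = δ b x * δ a y

length-filter-tabulate : ∀ {A : Set} {P : A → Set} (P? : Decidable P) {m} (f : Fin m → A) →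
  length (filter P? (tabulate f)) ≡ ∑[ i < m ] 𝟙 (P? (f i))
length-filter-tabulate P? {zero}  f = refl
length-filter-tabulate P? {suc m} f with does (P? (f fzero))
... | true  = cong suc (length-filter-tabulate P? (f ∘ fsuc))
... | false = length-filter-tabulate P? (f ∘ fsuc)

length-filter-cartesianProduct : ∀ {A B : Set} {P : A × B → Set} (P? : Decidable P) {m l}
  (f : Fin m → A) (g : Fin l → B) →
  length (filter P? (cartesianProduct (tabulate f) (tabulate g))) ≡ ∑[ i < m ] ∑[ j < l ] 𝟙 (P? (f i , g j))
length-filter-cartesianProduct P? {zero}  f g = refl
length-filter-cartesianProduct P? {suc m} f g = begin
  length (filter P? (map (f fzero ,_) (tabulate g) ++ rest))
    ≡⟨ cong length (filter-++ P? (map (f fzero ,_) (tabulate g)) rest) ⟩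
  length (filter P? (map (f fzero ,_) (tabulate g)) ++ filter P? rest)
    ≡⟨ length-++ (filter P? (map (f fzero ,_) (tabulate g))) ⟩
  length (filter P? (map (f fzero ,_) (tabulate g))) + length (filter P? rest)
    ≡⟨ cong₂ _+_ (trans (cong (length ∘ filter P?) (map-tabulate g (f fzero ,_)))
                        (length-filter-tabulate P? ((f fzero ,_) ∘ g)))
                 (length-filter-cartesianProduct P? (f ∘ fsuc) g) ⟩
  _ ∎
  where
  open ≡-Reasoning
  rest = cartesianProduct (tabulate (f ∘ fsuc)) (tabulate g)

module _ {n : ℕ} (G : SimpleGraph n) where
  open SimpleGraph G using (irrefl)

  Adj-sym : ∀ {x y} → Adj G x y → Adj G y x
  Adj-sym {x} {y} xy = trans (SimpleGraph.sym G y x) xy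

  Adj-irrefl : ∀ {x} → ¬ Adj G x x
  Adj-irrefl {x} xx with () ← trans (sym xx) (irrefl x)

  edge : Fin n → Fin n → ℕ
  edge x y = 𝟙 (Adj? G x y)

  edge-sym : ∀ x y → edge x y ≡ edge y x
  edge-sym x y = 𝟙-⇔ (mk⇔ Adj-sym Adj-sym) (Adj? G x y) (Adj? G y x)

  degree≡∑edge : ∀ x → degree G x ≡ ∑[ y < n ] edge x y
  degree≡∑edge x = length-filter-tabulate (Adj? G x) (λ y → y)

  degree≤1 : ∀ {x y} → (∀ w → Adj G y w → w ≡ x) → degree G y ≤ 1
  degree≤1 {x} {y} onlyX = begin
    degree G y           ≡⟨ degree≡∑edge y ⟩
    ∑[ w < n ] edge y w  ≤⟨ ∑-mono-≤ edge≤δ ⟩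
    ∑[ w < n ] δ x w     ≡⟨ ∑-δ x ⟩
    1                    ∎
    where
    open ≤-Reasoning
    edge≤δ : ∀ w → edge y w ≤ δ x w
    edge≤δ w with Adj? G y w
    ... | no _ = z≤n
    ... | yes yw with x ≟ w
    ...   | yes _ = ≤-refl
    ...   | no x≢w = contradiction (sym (onlyX w yw)) x≢w

  ∑∑-edge*δˡ : ∀ w → ∑∑ (λ x y → edge x y * δ w x) ≡ degree G w
  ∑∑-edge*δˡ w = trans (∑∑-*-δˡ w edge) (sym (degree≡∑edge w))

  ∑∑-edge*δʳ : ∀ w → ∑∑ (λ x y → edge x y * δ w y) ≡ degree G w
  ∑∑-edge*δʳ w = trans (∑∑-*-δʳ w edge) (trans (sum-cong-≗ (λ x → edge-sym x w)) (sym (degree≡∑edge w)))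

  ∑∑-edge-incidences : ∀ u v →
    ∑∑ (λ x y → edge x y * δ u x + edge x y * δ v x + edge x y * δ u y + edge x y * δ v y)
      ≡ degree G u + degree G v + degree G u + degree G v
  ∑∑-edge-incidences u v = begin
    ∑∑ (λ x y → [ux] x y + [vx] x y + [uy] x y + [vy] x y)
      ≡⟨ ∑∑-distrib-+ (λ x y → [ux] x y + [vx] x y + [uy] x y) [vy] ⟩
    ∑∑ (λ x y → [ux] x y + [vx] x y + [uy] x y) + ∑∑ [vy]
      ≡⟨ cong (_+ ∑∑ [vy]) (∑∑-distrib-+ (λ x y → [ux] x y + [vx] x y) [uy]) ⟩
    ∑∑ (λ x y → [ux] x y + [vx] x y) + ∑∑ [uy] + ∑∑ [vy]
      ≡⟨ cong (λ p → p + ∑∑ [uy] + ∑∑ [vy]) (∑∑-distrib-+ [ux] [vx]) ⟩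
    ∑∑ [ux] + ∑∑ [vx] + ∑∑ [uy] + ∑∑ [vy]
      ≡⟨ cong₂ _+_ (cong₂ _+_ (cong₂ _+_ (∑∑-edge*δˡ u) (∑∑-edge*δˡ v)) (∑∑-edge*δʳ u)) (∑∑-edge*δʳ v) ⟩
    degree G u + degree G v + degree G u + degree G v
      ∎
    where
    open ≡-Reasoning
    [ux] [vx] [uy] [vy] : Fin n → Fin n → ℕ
    [ux] x y = edge x y * δ u x
    [vx] x y = edge x y * δ v x
    [uy] x y = edge x y * δ u y
    [vy] x y = edge x y * δ v y

  otherNeighbour : ∀ {y} → 1 < degree G y → ∀ x → ∃ λ w → Adj G y w × w ≢ x
  otherNeighbour {y} 1<deg x with any? (λ w → Adj? G y w ×-dec ¬? (w ≟ x))
  ... | yes found = found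
  ... | no none = contradiction (degree≤1 onlyX) (<⇒≱ 1<deg)
    where
    onlyX : ∀ w → Adj G y w → w ≡ x
    onlyX w yw with w ≟ x
    ... | yes w≡x = w≡x
    ... | no w≢x = contradiction (w , yw , w≢x) none

  arc⇒A₁Vertex : ∀ {u v} → 1 < degree G v → Adj G u v → IsA₁Vertex G (u , v)
  arc⇒A₁Vertex {u} {v} 1<deg uv with otherNeighbour 1<deg u
  ... | w , vw , w≢u = (v , w) , uv , vw , refl , w≢u

  module _ (1<deg : ∀ v → 1 < degree G v) {u v : Fin n} (uv : Adj G u v) where

    A₁Adj⇔ : ∀ x y →
      A₁Adj G (u , v) (x , y) ⇔ (Adj G x y × ¬ (u ≡ x × v ≡ y) × ShareVertex G (u , v) (x , y))
    A₁Adj⇔ x y = mk⇔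
      (λ { (_ , (_ , xy , _) , uv≢xy , share) → xy , (λ { (refl , refl) → uv≢xy refl }) , share })
      (λ { (xy , ¬eq , share) →
           arc⇒A₁Vertex (1<deg v) uv , arc⇒A₁Vertex (1<deg y) xy , (λ { refl → ¬eq (refl , refl) }) , share })

    A₁Adj-arc? : ∀ x y → Dec (Adj G x y × ¬ (u ≡ x × v ≡ y) × ShareVertex G (u , v) (x , y))
    A₁Adj-arc? x y = Adj? G x y ×-dec ¬? ((u ≟ x) ×-dec (v ≟ y)) ×-dec ShareVertex? G (u , v) (x , y)

    A₁degree≡∑∑ : A₁degree G (u , v) ≡ ∑∑ (λ x y → 𝟙 (A₁Adj-arc? x y))
    A₁degree≡∑∑ = trans (length-filter-cartesianProduct (A₁Adj? G (u , v)) (λ x → x) (λ y → y))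
      (sum-cong-≗ λ x → sum-cong-≗ λ y → 𝟙-⇔ (A₁Adj⇔ x y) (A₁Adj? G (u , v) (x , y)) (A₁Adj-arc? x y))

    -- Each endpoint of an arc xy equals at most one of u, v, and both endpoints lie in {u, v}
    -- only for xy = uv and xy = vu; the δ δ terms correct the count for these two arcs.
    A₁Adj-incidences : ∀ x y →
      𝟙 (A₁Adj-arc? x y) + 2 * (δ u x * δ v y) + δ v x * δ u y
        ≡ edge x y * δ u x + edge x y * δ v x + edge x y * δ u y + edge x y * δ v y
    A₁Adj-incidences x y with Adj? G x y
    ... | no ¬xy = cong₂ (λ p q → 2 * p + q)
                     (δ*δ≡0 u v x y λ { (refl , refl) → ¬xy uv })
                     (δ*δ≡0 v u x y λ { (refl , refl) → ¬xy (Adj-sym uv) })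
    ... | yes xy with u ≟ x | v ≟ x | u ≟ y | v ≟ y
    ... | yes refl | yes refl | _        | _        = contradiction uv Adj-irrefl
    ... | _        | _        | yes refl | yes refl = contradiction uv Adj-irrefl
    ... | yes refl | no _     | yes refl | no _     = contradiction xy Adj-irrefl
    ... | no _     | yes refl | no _     | yes refl = contradiction xy Adj-irrefl
    ... | yes _    | no _     | no _     | yes _    = refl
    ... | yes _    | no _     | no _     | no _     = refl
    ... | no _     | yes _    | yes _    | no _     = refl
    ... | no _     | yes _    | no _     | no _     = refl
    ... | no _     | no _     | yes _    | no _     = refl
    ... | no _     | no _     | no _     | yes _    = refl
    ... | no _     | no _     | no _     | no _     = refl

    A₁degree-of-arc : A₁degree G (u , v) + 3 ≡ 2 * (degree G u + degree G v)
    A₁degree-of-arc = begin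
      A₁degree G (u , v) + 3
        ≡⟨ cong (_+ 3) A₁degree≡∑∑ ⟩
      ∑∑ (λ x y → 𝟙 (A₁Adj-arc? x y)) + 3
        ≡⟨ ∑∑-+δδ (λ x y → 𝟙 (A₁Adj-arc? x y)) u v ⟨
      ∑∑ (λ x y → 𝟙 (A₁Adj-arc? x y) + 2 * (δ u x * δ v y) + δ v x * δ u y)
        ≡⟨ sum-cong-≗ (λ x → sum-cong-≗ (A₁Adj-incidences x)) ⟩
      ∑∑ (λ x y → edge x y * δ u x + edge x y * δ v x + edge x y * δ u y + edge x y * δ v y)
        ≡⟨ ∑∑-edge-incidences u v ⟩
      degree G u + degree G v + degree G u + degree G v
        ≡⟨ twice (degree G u) (degree G v) ⟩
      2 * (degree G u + degree G v)
        ∎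
      where
      open ≡-Reasoning
      twice : ∀ a b → a + b + a + b ≡ 2 * (a + b)
      twice = solve-∀

mainTheorem19 : (n : ℕ) (G : SimpleGraph n) (k : ℕ) → k > 1 → Regular G k → A₁Regular G (4 * k ∸ 3)
mainTheorem19 n G k k>1 regular (u , v) (_ , uv , _) = begin
  A₁degree G (u , v)                 ≡⟨ m+n∸n≡m (A₁degree G (u , v)) 3 ⟨
  A₁degree G (u , v) + 3 ∸ 3         ≡⟨ cong (_∸ 3) (A₁degree-of-arc G 1<deg uv) ⟩
  2 * (degree G u + degree G v) ∸ 3  ≡⟨ cong₂ (λ p q → 2 * (p + q) ∸ 3) (regular u) (regular v) ⟩
  2 * (k + k) ∸ 3                    ≡⟨ cong (_∸ 3) (double k) ⟩
  4 * k ∸ 3                          ∎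
  where
  open ≡-Reasoning
  1<deg : ∀ w → 1 < degree G w
  1<deg w = subst (1 <_) (sym (regular w)) k>1
  double : ∀ k → 2 * (k + k) ≡ 4 * k
  double = solve-∀
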